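{- For every integer $n > 59$ there exists a regular $K_4$-saturated graph with $n$ vertices, and there exists a regular $K_5$-saturated graph with $n$ vertices.
   Context: All graphs are finite and simple. For a graph $F$, a graph $G$ is $F$-saturated if $G$ contains no subgraph isomorphic to $F$, but adding any edge between two nonadjacent vertices of $G$ creates a subgraph isomorphic to $F$. A graph is regular if all its vertices have the same degree. $K_s$ denotes the complete graph on $s$ vertices. -}

module Defs where

open import Data.Nat using (ℕ; _<_)
open import Data.Fin using (Fin)
open import Data.Product using (Σ; ∃; _×_; _,_)
open import Data.Sum using (_⊎_)
open import Data.List using (List; length; filter)
open import Data.List using (allFin)
open import Relation.Nullary using (¬_; Dec)
open import Relation.Binary.PropositionalEquality using (_≡_)
open import Function.Definitions using (Injective)

record Graph (n : ℕ) : Set₁ where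
  field
    Adj     : Fin n → Fin n → Set
    adj?    : (u v : Fin n) → Dec (Adj u v)
    irrefl  : ∀ u → ¬ Adj u u
    sym     : ∀ {u v} → Adj u v → Adj v u
open Graph public

degree : ∀ {n} (G : Graph n) → Fin n → ℕ
degree G u = length (filter (λ v → adj? G u v) (allFin _))

Regular : ∀ {n} → Graph n → Set
Regular {n} G = Σ ℕ λ d → ∀ (u : Fin n) → degree G u ≡ d

ContainsKRel : ∀ {n} → (Fin n → Fin n → Set) → ℕ → Set
ContainsKRel {n} A s =
  Σ (Fin s → Fin n) λ f → Injective _≡_ _≡_ f ×
    (∀ i j → ¬ i ≡ j → A (f i) (f j))

ContainsK : ∀ {n} → Graph n → ℕ → Set
ContainsK G s = ContainsKRel (Adj G) s

AddEdge : ∀ {n} → Graph n → Fin n → Fin n → (Fin n → Fin n → Set)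
AddEdge G u v x y = Adj G x y ⊎ ((x ≡ u × y ≡ v) ⊎ (x ≡ v × y ≡ u))

Saturated : ∀ {n} → Graph n → ℕ → Set
Saturated {n} G s =
  ¬ ContainsK G s ×
  (∀ (u v : Fin n) → ¬ u ≡ v → ¬ Adj G u v → ContainsKRel (AddEdge G u v) s)

-- The graphs are circulants on ℤ/n: x ~ y iff the cyclic distance between x and y lies in the
-- band [b, cb), with c = 3 for K₄ and c = 4 for K₅, and b = ⌊(n + 2)/(2c + 2)⌋, so that
-- 2(c+1)b - 2 ≤ n ≤ 2(c+2)b - 3 as soon as n ≥ 2(c+1)² - 2. Rotations are automorphisms, so the
-- graph is regular.
-- A K_{c+1} cuts the cycle into c+1 gaps, each at least b, and for every pair of its vertices one of
-- the two arcs between them is shorter than cb. Three suitable short arcs cover the cycle with c - 2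
-- gaps to spare (for c = 4 it can also happen that the five arcs spanning two consecutive gaps are
-- all short and cover the cycle twice); either way n ≤ 2(c+1)b - 3, a contradiction.
-- For a non-edge uv, rotate one endpoint to 0 so that the other one sits at a distance δ ≤ n/2 with
-- δ ∉ [b, cb). Then 0, δ and the progression t + b, …, t + (c-1)b form a K_{c+1} in G + uv, where
-- t = δ if δ < b, and otherwise t < b with cb ≤ δ - t < (c+1)b; the upper bound on n is what makes
-- such a t exist.
module Submission where

open import Data.Nat
open import Data.Nat.Properties
open import Data.Nat.DivMod using (_/_; _%_; m≡m%n+[m/n]*n; m%n<n; m*n/n≡m; /-monoˡ-≤)
open import Data.Nat.Tactic.RingSolver using (solve; solve-∀)
open import Data.Bool using (true; false; if_then_else_)
open import Data.Fin as Fin using (Fin; zero; suc; toℕ; fromℕ<)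
open import Data.Fin.Properties using (toℕ-fromℕ<; toℕ-injective; toℕ<n)
import Data.Fin.Properties as Finₚ
open import Data.Fin.Permutation using (Permutation′; permutation; _⟨$⟩ʳ_; _⟨$⟩ˡ_; inverseˡ; inverseʳ)
open import Data.List using (List; []; _∷_; length; filter; tabulate)
open import Data.Product using (Σ; _×_; _,_; proj₂; uncurry)
open import Data.Sum using (_⊎_; inj₁; inj₂; [_,_]′; swap)
import Data.Sum as Sum
open import Data.Empty using (⊥; ⊥-elim)
open import Function using (_∘_; _⇔_; mk⇔; Equivalence)
open import Function.Definitions using (Injective)
open import Relation.Nullary using (¬_; Dec; does; yes; no)
open import Relation.Nullary.Decidable using (does-⇔; _⊎-dec_; _×-dec_)
open import Relation.Unary using (Decidable)
open import Relation.Binary.Definitions using (tri<; tri≈; tri>)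
open import Relation.Binary.PropositionalEquality
open import Algebra.Properties.CommutativeMonoid.Sum +-0-commutativeMonoid using (sum; sum-permute; sum-cong-≗)
open import Defs hiding (sym)

-- Positions on the m-cycle are the naturals below m: for them offset x y is (y - x) mod m and
-- shift t x is (t + x) mod m (reduce subtracts m at most once).
module Cyclic (m : ℕ) where

  offset : ℕ → ℕ → ℕ
  offset x y with x ≤? y
  ... | yes _ = y ∸ x
  ... | no  _ = m + y ∸ x

  offset-≤ : ∀ {x y} → x ≤ y → offset x y ≡ y ∸ x
  offset-≤ {x} {y} x≤y with x ≤? y
  ... | yes _   = refl
  ... | no  x≰y = ⊥-elim (x≰y x≤y)

  offset-> : ∀ {x y} → y < x → offset x y ≡ m + y ∸ x
  offset-> {x} {y} y<x with x ≤? y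
  ... | yes x≤y = ⊥-elim (<⇒≱ y<x x≤y)
  ... | no  _   = refl

  reduce : ℕ → ℕ
  reduce y with y <? m
  ... | yes _ = y
  ... | no  _ = y ∸ m

  reduce-< : ∀ {y} → y < m → reduce y ≡ y
  reduce-< {y} y<m with y <? m
  ... | yes _   = refl
  ... | no  y≮m = ⊥-elim (y≮m y<m)

  reduce-≥ : ∀ {y} → m ≤ y → reduce y ≡ y ∸ m
  reduce-≥ {y} m≤y with y <? m
  ... | yes y<m = ⊥-elim (<⇒≱ y<m m≤y)
  ... | no  _   = refl

  reduce<m : ∀ {y} → y < m + m → reduce y < m
  reduce<m {y} y<2m with y <? m
  ... | yes y<m = y<m
  ... | no  y≮m = +-cancelʳ-< m _ _ (subst (_< m + m) (sym (m∸n+n≡m (≮⇒≥ y≮m))) y<2m)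

  shift : ℕ → ℕ → ℕ
  shift t x = reduce (t + x)

  shift<m : ∀ {t x} → t < m → x < m → shift t x < m
  shift<m t<m x<m = reduce<m (+-mono-< t<m x<m)

  offset-self : ∀ x → offset x x ≡ 0
  offset-self x = trans (offset-≤ {x} ≤-refl) (n∸n≡0 x)

  private
    m+x∸y≡m∸[y∸x] : ∀ {x y} → x ≤ y → m + x ∸ y ≡ m ∸ (y ∸ x)
    m+x∸y≡m∸[y∸x] {x} x≤y =
      trans (cong₂ _∸_ (+-comm m x) (sym (m+[n∸m]≡n x≤y))) ([m+n]∸[m+o]≡n∸o x m _)

  offset<m : ∀ {x y} → x < m → y < m → offset x y < m
  offset<m {x} {y} x<m y<m with ≤-<-connex x y
  ... | inj₁ x≤y = subst (_< m) (sym (offset-≤ x≤y)) (≤-<-trans (m∸n≤m y x) y<m)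
  ... | inj₂ y<x = subst (_< m) (sym (trans (offset-> y<x) (m+x∸y≡m∸[y∸x] (<⇒≤ y<x))))
                     (∸-monoʳ-< (m<n⇒0<n∸m y<x) (≤-trans (m∸n≤m x y) (<⇒≤ x<m)))

  offset-+-offset : ∀ {x y} → x < m → y < m → x ≢ y → offset x y + offset y x ≡ m
  offset-+-offset {x} {y} x<m y<m x≢y with <-cmp x y
  ... | tri≈ _ x≡y _ = ⊥-elim (x≢y x≡y)
  ... | tri< x<y _ _ = begin
    offset x y + offset y x   ≡⟨ cong₂ _+_ (offset-≤ (<⇒≤ x<y)) (trans (offset-> x<y) (m+x∸y≡m∸[y∸x] (<⇒≤ x<y))) ⟩
    (y ∸ x) + (m ∸ (y ∸ x))   ≡⟨ m+[n∸m]≡n (≤-trans (m∸n≤m y x) (<⇒≤ y<m)) ⟩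
    m                         ∎
    where open ≡-Reasoning
  ... | tri> _ _ y<x = begin
    offset x y + offset y x   ≡⟨ cong₂ _+_ (trans (offset-> y<x) (m+x∸y≡m∸[y∸x] (<⇒≤ y<x))) (offset-≤ (<⇒≤ y<x)) ⟩
    (m ∸ (x ∸ y)) + (x ∸ y)   ≡⟨ m∸n+n≡m (≤-trans (m∸n≤m x y) (<⇒≤ x<m)) ⟩
    m                         ∎
    where open ≡-Reasoning

  offset-trans : ∀ {x y z} → x ≤ y → y ≤ z → offset x z ≡ offset x y + offset y z
  offset-trans {x} {y} {z} x≤y y≤z = begin
    offset x z              ≡⟨ offset-≤ (≤-trans x≤y y≤z) ⟩
    z ∸ x                   ≡⟨ cong (_∸ x) (sym (m+[n∸m]≡n y≤z)) ⟩
    y + (z ∸ y) ∸ x         ≡⟨ +-∸-comm (z ∸ y) x≤y ⟩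
    (y ∸ x) + (z ∸ y)       ≡⟨ sym (cong₂ _+_ (offset-≤ x≤y) (offset-≤ y≤z)) ⟩
    offset x y + offset y z ∎
    where open ≡-Reasoning

  shift-offset : ∀ {x y} → x < m → y < m → shift x (offset x y) ≡ y
  shift-offset {x} {y} x<m y<m with ≤-<-connex x y
  ... | inj₁ x≤y = begin
    reduce (x + offset x y) ≡⟨ cong (λ d → reduce (x + d)) (offset-≤ x≤y) ⟩
    reduce (x + (y ∸ x))    ≡⟨ cong reduce (m+[n∸m]≡n x≤y) ⟩
    reduce y                ≡⟨ reduce-< y<m ⟩
    y                       ∎
    where open ≡-Reasoning
  ... | inj₂ y<x = begin
    reduce (x + offset x y) ≡⟨ cong (λ d → reduce (x + d)) (offset-> y<x) ⟩
    reduce (x + (m + y ∸ x)) ≡⟨ cong reduce (m+[n∸m]≡n (≤-trans (<⇒≤ x<m) (m≤m+n m y))) ⟩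
    reduce (m + y)          ≡⟨ reduce-≥ (m≤m+n m y) ⟩
    m + y ∸ m               ≡⟨ m+n∸m≡n m y ⟩
    y                       ∎
    where open ≡-Reasoning

  private
    [t+y]∸[t+x]≡y∸x : ∀ t x y → (t + y) ∸ (t + x) ≡ y ∸ x
    [t+y]∸[t+x]≡y∸x t x y = [m+n]∸[m+o]≡n∸o t y x

    m+[t+y]∸[t+x]≡m+y∸x : ∀ t x y → m + (t + y) ∸ (t + x) ≡ m + y ∸ x
    m+[t+y]∸[t+x]≡m+y∸x t x y =
      trans (cong (_∸ (t + x)) m+[t+y]≡t+[m+y]) ([m+n]∸[m+o]≡n∸o t (m + y) x)
      where
      m+[t+y]≡t+[m+y] : m + (t + y) ≡ t + (m + y)
      m+[t+y]≡t+[m+y] = trans (sym (+-assoc m t y)) (trans (cong (_+ y) (+-comm m t)) (+-assoc t m y))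

    [y∸m]∸[x∸m]≡y∸x : ∀ {x y} → m ≤ x → m ≤ y → (y ∸ m) ∸ (x ∸ m) ≡ y ∸ x
    [y∸m]∸[x∸m]≡y∸x m≤x m≤y =
      sym (trans (cong₂ _∸_ (sym (m+[n∸m]≡n m≤y)) (sym (m+[n∸m]≡n m≤x))) ([m+n]∸[m+o]≡n∸o m _ _))

    y∸[x∸m]≡m+y∸x : ∀ {x y} → m ≤ x → y ∸ (x ∸ m) ≡ m + y ∸ x
    y∸[x∸m]≡m+y∸x {x} {y} m≤x =
      trans (sym ([m+n]∸[m+o]≡n∸o m y (x ∸ m))) (cong (m + y ∸_) (m+[n∸m]≡n m≤x))

    offset-shift-≤ : ∀ {t x y} → x ≤ y → y < m → offset (shift t x) (shift t y) ≡ offset x y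
    offset-shift-≤ {t} {x} {y} x≤y y<m with ≤-<-connex m (t + x) | ≤-<-connex m (t + y)
    ... | _ | inj₂ t+y<m = begin
      offset (reduce (t + x)) (reduce (t + y)) ≡⟨ cong₂ offset (reduce-< (≤-<-trans (+-monoʳ-≤ t x≤y) t+y<m)) (reduce-< t+y<m) ⟩
      offset (t + x) (t + y)                   ≡⟨ offset-≤ (+-monoʳ-≤ t x≤y) ⟩
      (t + y) ∸ (t + x)                        ≡⟨ [t+y]∸[t+x]≡y∸x t x y ⟩
      y ∸ x                                    ≡⟨ offset-≤ x≤y ⟨
      offset x y                               ∎
      where open ≡-Reasoning
    ... | inj₂ t+x<m | inj₁ m≤t+y = begin
      offset (reduce (t + x)) (reduce (t + y)) ≡⟨ cong₂ offset (reduce-< t+x<m) (reduce-≥ m≤t+y) ⟩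
      offset (t + x) (t + y ∸ m)               ≡⟨ offset-> (+-cancelʳ-< m _ _ wrapped-below) ⟩
      m + (t + y ∸ m) ∸ (t + x)                ≡⟨ cong (_∸ (t + x)) (m+[n∸m]≡n m≤t+y) ⟩
      (t + y) ∸ (t + x)                        ≡⟨ [t+y]∸[t+x]≡y∸x t x y ⟩
      y ∸ x                                    ≡⟨ offset-≤ x≤y ⟨
      offset x y                               ∎
      where
      open ≡-Reasoning
      wrapped-below : t + y ∸ m + m < t + x + m
      wrapped-below = subst (_< t + x + m) (sym (m∸n+n≡m m≤t+y)) (+-mono-≤-< (m≤m+n t x) y<m)
    ... | inj₁ m≤t+x | inj₁ m≤t+y = begin
      offset (reduce (t + x)) (reduce (t + y)) ≡⟨ cong₂ offset (reduce-≥ m≤t+x) (reduce-≥ m≤t+y) ⟩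
      offset (t + x ∸ m) (t + y ∸ m)           ≡⟨ offset-≤ (∸-monoˡ-≤ m (+-monoʳ-≤ t x≤y)) ⟩
      (t + y ∸ m) ∸ (t + x ∸ m)                ≡⟨ [y∸m]∸[x∸m]≡y∸x m≤t+x m≤t+y ⟩
      (t + y) ∸ (t + x)                        ≡⟨ [t+y]∸[t+x]≡y∸x t x y ⟩
      y ∸ x                                    ≡⟨ offset-≤ x≤y ⟨
      offset x y                               ∎
      where open ≡-Reasoning

    offset-shift-> : ∀ {t x y} → y < x → x < m → offset (shift t x) (shift t y) ≡ offset x y
    offset-shift-> {t} {x} {y} y<x x<m with ≤-<-connex m (t + x) | ≤-<-connex m (t + y)
    ... | inj₂ t+x<m | _ = begin
      offset (reduce (t + x)) (reduce (t + y)) ≡⟨ cong₂ offset (reduce-< t+x<m) (reduce-< (<-trans (+-monoʳ-< t y<x) t+x<m)) ⟩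
      offset (t + x) (t + y)                   ≡⟨ offset-> (+-monoʳ-< t y<x) ⟩
      m + (t + y) ∸ (t + x)                    ≡⟨ m+[t+y]∸[t+x]≡m+y∸x t x y ⟩
      m + y ∸ x                                ≡⟨ offset-> y<x ⟨
      offset x y                               ∎
      where open ≡-Reasoning
    ... | inj₁ m≤t+x | inj₂ t+y<m = begin
      offset (reduce (t + x)) (reduce (t + y)) ≡⟨ cong₂ offset (reduce-≥ m≤t+x) (reduce-< t+y<m) ⟩
      offset (t + x ∸ m) (t + y)               ≡⟨ offset-≤ unwrapped-below ⟩
      (t + y) ∸ (t + x ∸ m)                    ≡⟨ y∸[x∸m]≡m+y∸x m≤t+x ⟩
      m + (t + y) ∸ (t + x)                    ≡⟨ m+[t+y]∸[t+x]≡m+y∸x t x y ⟩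
      m + y ∸ x                                ≡⟨ offset-> y<x ⟨
      offset x y                               ∎
      where
      open ≡-Reasoning
      unwrapped-below : t + x ∸ m ≤ t + y
      unwrapped-below = ≤-trans (∸-monoˡ-≤ m (+-monoʳ-≤ t (<⇒≤ x<m))) (≤-trans (≤-reflexive (m+n∸n≡m t m)) (m≤m+n t y))
    ... | inj₁ m≤t+x | inj₁ m≤t+y = begin
      offset (reduce (t + x)) (reduce (t + y)) ≡⟨ cong₂ offset (reduce-≥ m≤t+x) (reduce-≥ m≤t+y) ⟩
      offset (t + x ∸ m) (t + y ∸ m)           ≡⟨ offset-> (∸-monoˡ-< (+-monoʳ-< t y<x) m≤t+y) ⟩
      m + (t + y ∸ m) ∸ (t + x ∸ m)            ≡⟨ cong (_∸ (t + x ∸ m)) (m+[n∸m]≡n m≤t+y) ⟩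
      (t + y) ∸ (t + x ∸ m)                    ≡⟨ y∸[x∸m]≡m+y∸x m≤t+x ⟩
      m + (t + y) ∸ (t + x)                    ≡⟨ m+[t+y]∸[t+x]≡m+y∸x t x y ⟩
      m + y ∸ x                                ≡⟨ offset-> y<x ⟨
      offset x y                               ∎
      where open ≡-Reasoning

  offset-shift : ∀ {t x y} → x < m → y < m → offset (shift t x) (shift t y) ≡ offset x y
  offset-shift {t} {x} {y} x<m y<m with ≤-<-connex x y
  ... | inj₁ x≤y = offset-shift-≤ x≤y y<m
  ... | inj₂ y<x = offset-shift-> y<x x<m

  shift-zero : ∀ {t} → t < m → shift t 0 ≡ t
  shift-zero {t} t<m = trans (cong reduce (+-identityʳ t)) (reduce-< t<m)

  offset-from-shift : ∀ {t y} → t < m → y < m → offset t (shift t y) ≡ y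
  offset-from-shift {t} {y} t<m y<m = begin
    offset t (shift t y)             ≡⟨ cong (λ s → offset s (shift t y)) (shift-zero t<m) ⟨
    offset (shift t 0) (shift t y)   ≡⟨ offset-shift (≤-<-trans z≤n t<m) y<m ⟩
    offset 0 y                       ≡⟨ offset-≤ z≤n ⟩
    y                                ∎
    where open ≡-Reasoning

  offset-positive : ∀ {x y} → x < m → y < m → x ≢ y → 0 < offset x y
  offset-positive {x} {y} x<m y<m x≢y = n≢0⇒n>0 λ offset≡0 → x≢y (begin
    x                  ≡⟨ shift-zero x<m ⟨
    shift x 0          ≡⟨ cong (shift x) offset≡0 ⟨
    shift x (offset x y) ≡⟨ shift-offset x<m y<m ⟩
    y                  ∎)
    where open ≡-Reasoning

indicator : ∀ {p} {P : Set p} → Dec P → ℕ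
indicator P? = if does P? then 1 else 0

length-filter-tabulate : ∀ {a p n} {A : Set a} {P : A → Set p} (P? : Decidable P) (f : Fin n → A) →
  length (filter P? (tabulate f)) ≡ sum (λ i → indicator (P? (f i)))
length-filter-tabulate {n = zero}  P? f = refl
length-filter-tabulate {n = suc n} P? f with does (P? (f zero))
... | true  = cong suc (length-filter-tabulate P? (f ∘ suc))
... | false = length-filter-tabulate P? (f ∘ suc)

module _ {n : ℕ} (G : Graph n) where

  IsAutomorphism : Permutation′ n → Set
  IsAutomorphism π = ∀ x y → Adj G (π ⟨$⟩ʳ x) (π ⟨$⟩ʳ y) ⇔ Adj G x y

  degree-automorphism : ∀ π → IsAutomorphism π → ∀ x → degree G (π ⟨$⟩ʳ x) ≡ degree G x
  degree-automorphism π π-aut x = begin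
    degree G (π ⟨$⟩ʳ x)                                   ≡⟨ length-filter-tabulate (adj? G (π ⟨$⟩ʳ x)) (λ v → v) ⟩
    sum (λ v → indicator (adj? G (π ⟨$⟩ʳ x) v))             ≡⟨ sum-permute _ π ⟩
    sum (λ w → indicator (adj? G (π ⟨$⟩ʳ x) (π ⟨$⟩ʳ w)))   ≡⟨ sum-cong-≗ (λ w → cong (λ b → if b then 1 else 0)
                                                             (does-⇔ (π-aut x w) (adj? G _ _) (adj? G x w))) ⟩
    sum (λ w → indicator (adj? G x w))                     ≡⟨ length-filter-tabulate (adj? G x) (λ v → v) ⟨
    degree G x                                            ∎
    where open ≡-Reasoning

module _ {n : ℕ} (A : Fin n → Fin n → Set) (irreflexive : ∀ x → ¬ A x x) where

  pairwise-injective : ∀ {s} (f : Fin s → Fin n) → (∀ i j → i ≢ j → A (f i) (f j)) → Injective _≡_ _≡_ f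
  pairwise-injective f adj {i} {j} fi≡fj with i Fin.≟ j
  ... | yes i≡j = i≡j
  ... | no  i≢j = ⊥-elim (irreflexive (f j) (subst (λ z → A z (f j)) fi≡fj (adj i j i≢j)))

  clique : ∀ {s} (f : Fin s → Fin n) → (∀ i j → i ≢ j → A (f i) (f j)) → ContainsKRel A s
  clique f adj = f , pairwise-injective f adj , adj

module _ {n : ℕ} (G : Graph n) where

  AddEdge-irreflexive : ∀ {u v} → u ≢ v → ∀ x → ¬ AddEdge G u v x x
  AddEdge-irreflexive u≢v x (inj₁ x~x)              = irrefl G x x~x
  AddEdge-irreflexive u≢v x (inj₂ (inj₁ (x≡u , x≡v))) = u≢v (trans (sym x≡u) x≡v)
  AddEdge-irreflexive u≢v x (inj₂ (inj₂ (x≡v , x≡u))) = u≢v (trans (sym x≡u) x≡v)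

  clique-through-edge : ∀ {k u v} (w : Fin k → Fin n) → u ≢ v →
    (∀ i → Adj G u (w i)) → (∀ i → Adj G v (w i)) → (∀ {i j} → i Fin.< j → Adj G (w i) (w j)) →
    ContainsKRel (AddEdge G u v) (2 + k)
  clique-through-edge {k} {u} {v} w u≢v u~w v~w w~w = clique (AddEdge G u v) (AddEdge-irreflexive u≢v) f adj
    where
    f : Fin (2 + k) → Fin n
    f zero             = u
    f (suc zero)       = v
    f (suc (suc i))    = w i
    adj : ∀ i j → i ≢ j → AddEdge G u v (f i) (f j)
    adj zero          zero          i≢j = ⊥-elim (i≢j refl)
    adj zero          (suc zero)    _   = inj₂ (inj₁ (refl , refl))
    adj zero          (suc (suc j)) _   = inj₁ (u~w j)
    adj (suc zero)    zero          _   = inj₂ (inj₂ (refl , refl))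
    adj (suc zero)    (suc zero)    i≢j = ⊥-elim (i≢j refl)
    adj (suc zero)    (suc (suc j)) _   = inj₁ (v~w j)
    adj (suc (suc i)) zero          _   = inj₁ (Graph.sym G (u~w i))
    adj (suc (suc i)) (suc zero)    _   = inj₁ (Graph.sym G (v~w i))
    adj (suc (suc i)) (suc (suc j)) i≢j with Finₚ.<-cmp i j
    ... | tri< i<j _ _ = inj₁ (w~w i<j)
    ... | tri≈ _ i≡j _ = ⊥-elim (i≢j (cong (λ i → suc (suc i)) i≡j))
    ... | tri> _ _ j<i = inj₁ (Graph.sym G (w~w j<i))

  automorphism-clique : ∀ π → IsAutomorphism G π → ∀ {a a' s} →
    ContainsKRel (AddEdge G a a') s → ContainsKRel (AddEdge G (π ⟨$⟩ʳ a) (π ⟨$⟩ʳ a')) s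
  automorphism-clique π π-aut (f , f-injective , f-adj) =
    (π ⟨$⟩ʳ_) ∘ f , f-injective ∘ π-injective , λ i j i≢j → image (f-adj i j i≢j)
    where
    π-injective : Injective _≡_ _≡_ (π ⟨$⟩ʳ_)
    π-injective {x} {y} πx≡πy = trans (sym (inverseˡ π)) (trans (cong (π ⟨$⟩ˡ_) πx≡πy) (inverseˡ π))
    image : ∀ {a a' x y} → AddEdge G a a' x y → AddEdge G (π ⟨$⟩ʳ a) (π ⟨$⟩ʳ a') (π ⟨$⟩ʳ x) (π ⟨$⟩ʳ y)
    image {x = x} {y} (inj₁ x~y)                = inj₁ (Equivalence.from (π-aut x y) x~y)
    image (inj₂ (inj₁ (x≡a , y≡a')))           = inj₂ (inj₁ (cong (π ⟨$⟩ʳ_) x≡a , cong (π ⟨$⟩ʳ_) y≡a'))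
    image (inj₂ (inj₂ (x≡a' , y≡a)))           = inj₂ (inj₂ (cong (π ⟨$⟩ʳ_) x≡a' , cong (π ⟨$⟩ʳ_) y≡a))

  AddEdge-swap : ∀ {u v s} → ContainsKRel (AddEdge G v u) s → ContainsKRel (AddEdge G u v) s
  AddEdge-swap (f , f-injective , f-adj) = f , f-injective , λ i j i≢j → swap-edge (f-adj i j i≢j)
    where
    swap-edge : ∀ {u v x y} → AddEdge G v u x y → AddEdge G u v x y
    swap-edge (inj₁ x~y)       = inj₁ x~y
    swap-edge (inj₂ (inj₁ xy)) = inj₂ (inj₂ xy)
    swap-edge (inj₂ (inj₂ xy)) = inj₂ (inj₁ xy)

regular-if-degrees-agree : ∀ {n} (G : Graph n) → (∀ u v → degree G u ≡ degree G v) → Regular G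
regular-if-degrees-agree {zero}  G agree = 0 , λ ()
regular-if-degrees-agree {suc n} G agree = degree G Fin.zero , λ u → agree u Fin.zero

module Circulant (m : ℕ) (D : ℕ → Set) (D? : Decidable D) (¬D0 : ¬ D 0) where
  open import Data.List.Properties using (length-tabulate)
  open import Data.List.Relation.Unary.All using (All; []; _∷_)
  import Data.List.Relation.Unary.All.Properties as All
  open import Data.List.Relation.Unary.AllPairs using (AllPairs; []; _∷_)
  import Data.List.Relation.Unary.AllPairs.Properties as AllPairs
  open import Data.List.Relation.Binary.Permutation.Propositional using (↭-sym; ↭⇒↭ₛ)
  open import Data.List.Relation.Binary.Permutation.Propositional.Properties using (All-resp-↭; ↭-length)
  open import Data.List.Relation.Binary.Permutation.Setoid.Properties (setoid ℕ) using (AllPairs-resp-↭)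
  open import Data.List.Relation.Unary.Sorted.TotalOrder.Properties using (Sorted⇒AllPairs)
  open import Data.List.Sort ≤-decTotalOrder using (sort; sort-↭; sort-↗)

  open Cyclic m

  Chord : ℕ → ℕ → Set
  Chord a a′ = D a ⊎ D a′

  Adjacent : ℕ → ℕ → Set
  Adjacent x y = Chord (offset x y) (offset y x)

  Adjacent-irreflexive : ∀ x → ¬ Adjacent x x
  Adjacent-irreflexive x = [ ¬D0 , ¬D0 ]′ ∘ Sum.map (subst D (offset-self x)) (subst D (offset-self x))

  circulant : Graph m
  circulant = record
    { Adj    = λ u v → Adjacent (toℕ u) (toℕ v)
    ; adj?   = λ u v → D? (offset (toℕ u) (toℕ v)) ⊎-dec D? (offset (toℕ v) (toℕ u))
    ; irrefl = λ u → Adjacent-irreflexive (toℕ u)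
    ; sym    = swap
    }

  position : ∀ {o} → .(o < m) → Fin m
  position o<m = fromℕ< o<m

  rotation : Fin m → Permutation′ m
  rotation u = permutation forward backward forward∘backward backward∘forward
    where
    forward backward : Fin m → Fin m
    forward  v = position (shift<m (toℕ<n u) (toℕ<n v))
    backward v = position (offset<m (toℕ<n u) (toℕ<n v))
    forward∘backward : ∀ v → forward (backward v) ≡ v
    forward∘backward v = toℕ-injective (begin
      toℕ (forward (backward v))               ≡⟨ toℕ-fromℕ< _ ⟩
      shift (toℕ u) (toℕ (backward v))         ≡⟨ cong (shift (toℕ u)) (toℕ-fromℕ< _) ⟩
      shift (toℕ u) (offset (toℕ u) (toℕ v))   ≡⟨ shift-offset (toℕ<n u) (toℕ<n v) ⟩
      toℕ v                                    ∎)
      where open ≡-Reasoning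
    backward∘forward : ∀ v → backward (forward v) ≡ v
    backward∘forward v = toℕ-injective (begin
      toℕ (backward (forward v))               ≡⟨ toℕ-fromℕ< _ ⟩
      offset (toℕ u) (toℕ (forward v))         ≡⟨ cong (offset (toℕ u)) (toℕ-fromℕ< _) ⟩
      offset (toℕ u) (shift (toℕ u) (toℕ v))   ≡⟨ offset-from-shift (toℕ<n u) (toℕ<n v) ⟩
      toℕ v                                    ∎)
      where open ≡-Reasoning

  toℕ-rotation : ∀ u v → toℕ (rotation u ⟨$⟩ʳ v) ≡ shift (toℕ u) (toℕ v)
  toℕ-rotation u v = toℕ-fromℕ< _

  rotation-automorphism : ∀ u → IsAutomorphism circulant (rotation u)
  rotation-automorphism u x y = mk⇔ (subst₂ Chord (invariant x y) (invariant y x))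
                                    (subst₂ Chord (sym (invariant x y)) (sym (invariant y x)))
    where
    invariant : ∀ x y → offset (toℕ (rotation u ⟨$⟩ʳ x)) (toℕ (rotation u ⟨$⟩ʳ y)) ≡ offset (toℕ x) (toℕ y)
    invariant x y = trans (cong₂ offset (toℕ-rotation u x) (toℕ-rotation u y))
                          (offset-shift (toℕ<n x) (toℕ<n y))

  rotation-origin : ∀ u o → toℕ o ≡ 0 → rotation u ⟨$⟩ʳ o ≡ u
  rotation-origin u o o≡0 = toℕ-injective (begin
    toℕ (rotation u ⟨$⟩ʳ o)   ≡⟨ toℕ-rotation u o ⟩
    shift (toℕ u) (toℕ o)     ≡⟨ cong (shift (toℕ u)) o≡0 ⟩
    shift (toℕ u) 0           ≡⟨ shift-zero (toℕ<n u) ⟩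
    toℕ u                     ∎)
    where open ≡-Reasoning

  circulant-regular : Regular circulant
  circulant-regular = regular-if-degrees-agree circulant λ u v → begin
    degree circulant u            ≡⟨ degree-from-origin u ⟨
    degree circulant (origin u)   ≡⟨ cong (degree circulant) (origins-agree u v) ⟩
    degree circulant (origin v)   ≡⟨ degree-from-origin v ⟩
    degree circulant v            ∎
    where
    open ≡-Reasoning
    origin : Fin m → Fin m
    origin u = position (≤-trans (s≤s z≤n) (toℕ<n u))
    origins-agree : ∀ u v → origin u ≡ origin v
    origins-agree u v = toℕ-injective (trans (toℕ-fromℕ< _) (sym (toℕ-fromℕ< _)))
    degree-from-origin : ∀ u → degree circulant (origin u) ≡ degree circulant u
    degree-from-origin u = trans (sym (degree-automorphism circulant (rotation u) (rotation-automorphism u) (origin u)))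
                                 (cong (degree circulant) (rotation-origin u (origin u) (toℕ-fromℕ< _)))

  adjacent-arcs : ∀ {x y a} a′ → x < m → y < m → Adjacent x y → offset x y ≡ a → a + a′ ≡ m → Chord a a′
  adjacent-arcs {x} {y} {a} a′ x<m y<m x~y arc a+a′≡m = subst₂ Chord arc co-arc x~y
    where
    co-arc : offset y x ≡ a′
    co-arc = +-cancelˡ-≡ a _ _ (begin
      a + offset y x            ≡⟨ cong (_+ offset y x) arc ⟨
      offset x y + offset y x   ≡⟨ offset-+-offset x<m y<m (λ { refl → Adjacent-irreflexive x x~y }) ⟩
      m                         ≡⟨ a+a′≡m ⟨
      a + a′                    ∎)
      where open ≡-Reasoning

  clique-positions : ∀ {s} → ContainsK circulant s →
    Σ (List ℕ) λ ps → length ps ≡ s × AllPairs _≤_ ps × AllPairs Adjacent ps × All (_< m) ps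
  clique-positions {s} (f , _ , f-adj) =
    sort ps ,
    trans (↭-length (sort-↭ ps)) (length-tabulate _) ,
    Sorted⇒AllPairs ≤-totalOrder (sort-↗ ps) ,
    AllPairs-resp-↭ swap (resp₂ Adjacent) (↭⇒↭ₛ (↭-sym (sort-↭ ps))) (AllPairs.tabulate⁺ (λ {i} {j} i≢j → f-adj i j i≢j)) ,
    All-resp-↭ (↭-sym (sort-↭ ps)) (All.tabulate⁺ (λ i → toℕ<n (f i)))
    where
    ps : List ℕ
    ps = tabulate (toℕ ∘ f)

  -- A 4-clique sorted around the cycle: gᵢ is the gap after its i-th vertex, and every pair of
  -- clique vertices gives a chord between the two arcs joining them.
  record CyclicGaps₄ : Set where
    field
      g₁ g₂ g₃ g₄ : ℕ
      total       : g₁ + g₂ + g₃ + g₄ ≡ m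
      chord₁      : Chord g₁ (g₂ + g₃ + g₄)
      chord₂      : Chord g₂ (g₃ + g₄ + g₁)
      chord₃      : Chord g₃ (g₄ + g₁ + g₂)
      chord₄      : Chord g₄ (g₁ + g₂ + g₃)
      chord₁₂     : Chord (g₁ + g₂) (g₃ + g₄)
      chord₂₃     : Chord (g₂ + g₃) (g₄ + g₁)

  rotate₄ : CyclicGaps₄ → CyclicGaps₄
  rotate₄ C = record
    { g₁ = g₂ ; g₂ = g₃ ; g₃ = g₄ ; g₄ = g₁
    ; total   = trans (+-rotate g₁ g₂ g₃ g₄) total
    ; chord₁  = chord₂
    ; chord₂  = chord₃
    ; chord₃  = chord₄
    ; chord₄  = chord₁
    ; chord₁₂ = chord₂₃
    ; chord₂₃ = swap chord₁₂
    }
    where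
    open CyclicGaps₄ C
    +-rotate : ∀ a b c d → b + c + d + a ≡ a + b + c + d
    +-rotate = solve-∀

  cyclic-gaps₄ : ContainsK circulant 4 → CyclicGaps₄
  cyclic-gaps₄ K with clique-positions K
  ... | (p₁ ∷ p₂ ∷ p₃ ∷ p₄ ∷ []) , refl
      , ((p₁≤p₂ ∷ _ ∷ _ ∷ []) ∷ (p₂≤p₃ ∷ _ ∷ []) ∷ (p₃≤p₄ ∷ []) ∷ [] ∷ [])
      , ((a₁₂ ∷ a₁₃ ∷ a₁₄ ∷ []) ∷ (a₂₃ ∷ a₂₄ ∷ []) ∷ (a₃₄ ∷ []) ∷ [] ∷ [])
      , (p₁<m ∷ p₂<m ∷ p₃<m ∷ p₄<m ∷ []) = from-gaps _ _ _ _ refl refl refl refl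
    where
    from-gaps : ∀ g₁ g₂ g₃ g₄ → offset p₁ p₂ ≡ g₁ → offset p₂ p₃ ≡ g₂ → offset p₃ p₄ ≡ g₃ → offset p₄ p₁ ≡ g₄ →
                CyclicGaps₄
    from-gaps g₁ g₂ g₃ g₄ e₁ e₂ e₃ e₄ = record
      { g₁ = g₁ ; g₂ = g₂ ; g₃ = g₃ ; g₄ = g₄
      ; total   = total
      ; chord₁  = adjacent-arcs (g₂ + g₃ + g₄) p₁<m p₂<m a₁₂ e₁ (by-total (solve gaps))
      ; chord₂  = adjacent-arcs (g₃ + g₄ + g₁) p₂<m p₃<m a₂₃ e₂ (by-total (solve gaps))
      ; chord₃  = adjacent-arcs (g₄ + g₁ + g₂) p₃<m p₄<m a₃₄ e₃ (by-total (solve gaps))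
      ; chord₄  = swap (adjacent-arcs g₄ p₁<m p₄<m a₁₄ arc₁₄ total)
      ; chord₁₂ = adjacent-arcs (g₃ + g₄) p₁<m p₃<m a₁₃ arc₁₃ (by-total (solve gaps))
      ; chord₂₃ = adjacent-arcs (g₄ + g₁) p₂<m p₄<m a₂₄ arc₂₄ (by-total (solve gaps))
      }
      where
      arc₁₃ : offset p₁ p₃ ≡ g₁ + g₂
      arc₁₃ = trans (offset-trans p₁≤p₂ p₂≤p₃) (cong₂ _+_ e₁ e₂)
      arc₂₄ : offset p₂ p₄ ≡ g₂ + g₃
      arc₂₄ = trans (offset-trans p₂≤p₃ p₃≤p₄) (cong₂ _+_ e₂ e₃)
      arc₁₄ : offset p₁ p₄ ≡ g₁ + g₂ + g₃
      arc₁₄ = trans (offset-trans (≤-trans p₁≤p₂ p₂≤p₃) p₃≤p₄) (cong₂ _+_ arc₁₃ e₃)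
      total : g₁ + g₂ + g₃ + g₄ ≡ m
      total = trans (cong₂ _+_ (sym arc₁₄) (sym e₄))
                    (offset-+-offset p₁<m p₄<m (λ { refl → Adjacent-irreflexive p₁ a₁₄ }))
      by-total : ∀ {s} → s ≡ g₁ + g₂ + g₃ + g₄ → s ≡ m
      by-total s≡ = trans s≡ total
      gaps : List ℕ
      gaps = g₁ ∷ g₂ ∷ g₃ ∷ g₄ ∷ []

  record CyclicGaps₅ : Set where
    field
      g₁ g₂ g₃ g₄ g₅ : ℕ
      total          : g₁ + g₂ + g₃ + g₄ + g₅ ≡ m
      chord₁         : Chord g₁ (g₂ + g₃ + g₄ + g₅)
      chord₂         : Chord g₂ (g₃ + g₄ + g₅ + g₁)
      chord₃         : Chord g₃ (g₄ + g₅ + g₁ + g₂)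
      chord₄         : Chord g₄ (g₅ + g₁ + g₂ + g₃)
      chord₅         : Chord g₅ (g₁ + g₂ + g₃ + g₄)
      chord₁₂        : Chord (g₁ + g₂) (g₃ + g₄ + g₅)
      chord₂₃        : Chord (g₂ + g₃) (g₄ + g₅ + g₁)
      chord₃₄        : Chord (g₃ + g₄) (g₅ + g₁ + g₂)
      chord₄₅        : Chord (g₄ + g₅) (g₁ + g₂ + g₃)
      chord₅₁        : Chord (g₅ + g₁) (g₂ + g₃ + g₄)

  rotate₅ : CyclicGaps₅ → CyclicGaps₅
  rotate₅ C = record
    { g₁ = g₂ ; g₂ = g₃ ; g₃ = g₄ ; g₄ = g₅ ; g₅ = g₁
    ; total   = trans (+-rotate g₁ g₂ g₃ g₄ g₅) total
    ; chord₁  = chord₂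
    ; chord₂  = chord₃
    ; chord₃  = chord₄
    ; chord₄  = chord₅
    ; chord₅  = chord₁
    ; chord₁₂ = chord₂₃
    ; chord₂₃ = chord₃₄
    ; chord₃₄ = chord₄₅
    ; chord₄₅ = chord₅₁
    ; chord₅₁ = chord₁₂
    }
    where
    open CyclicGaps₅ C
    +-rotate : ∀ a b c d e → b + c + d + e + a ≡ a + b + c + d + e
    +-rotate = solve-∀

  cyclic-gaps₅ : ContainsK circulant 5 → CyclicGaps₅
  cyclic-gaps₅ K with clique-positions K
  ... | (p₁ ∷ p₂ ∷ p₃ ∷ p₄ ∷ p₅ ∷ []) , refl
      , ((p₁≤p₂ ∷ _ ∷ _ ∷ _ ∷ []) ∷ (p₂≤p₃ ∷ _ ∷ _ ∷ []) ∷ (p₃≤p₄ ∷ _ ∷ []) ∷ (p₄≤p₅ ∷ []) ∷ [] ∷ [])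
      , ((a₁₂ ∷ a₁₃ ∷ a₁₄ ∷ a₁₅ ∷ []) ∷ (a₂₃ ∷ a₂₄ ∷ a₂₅ ∷ []) ∷ (a₃₄ ∷ a₃₅ ∷ []) ∷ (a₄₅ ∷ []) ∷ [] ∷ [])
      , (p₁<m ∷ p₂<m ∷ p₃<m ∷ p₄<m ∷ p₅<m ∷ []) = from-gaps _ _ _ _ _ refl refl refl refl refl
    where
    from-gaps : ∀ g₁ g₂ g₃ g₄ g₅ → offset p₁ p₂ ≡ g₁ → offset p₂ p₃ ≡ g₂ → offset p₃ p₄ ≡ g₃ →
                offset p₄ p₅ ≡ g₄ → offset p₅ p₁ ≡ g₅ → CyclicGaps₅
    from-gaps g₁ g₂ g₃ g₄ g₅ e₁ e₂ e₃ e₄ e₅ = record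
      { g₁ = g₁ ; g₂ = g₂ ; g₃ = g₃ ; g₄ = g₄ ; g₅ = g₅
      ; total   = total
      ; chord₁  = adjacent-arcs (g₂ + g₃ + g₄ + g₅) p₁<m p₂<m a₁₂ e₁ (by-total (solve gaps))
      ; chord₂  = adjacent-arcs (g₃ + g₄ + g₅ + g₁) p₂<m p₃<m a₂₃ e₂ (by-total (solve gaps))
      ; chord₃  = adjacent-arcs (g₄ + g₅ + g₁ + g₂) p₃<m p₄<m a₃₄ e₃ (by-total (solve gaps))
      ; chord₄  = adjacent-arcs (g₅ + g₁ + g₂ + g₃) p₄<m p₅<m a₄₅ e₄ (by-total (solve gaps))
      ; chord₅  = swap (adjacent-arcs g₅ p₁<m p₅<m a₁₅ arc₁₅ total)
      ; chord₁₂ = adjacent-arcs (g₃ + g₄ + g₅) p₁<m p₃<m a₁₃ arc₁₃ (by-total (solve gaps))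
      ; chord₂₃ = adjacent-arcs (g₄ + g₅ + g₁) p₂<m p₄<m a₂₄ arc₂₄ (by-total (solve gaps))
      ; chord₃₄ = adjacent-arcs (g₅ + g₁ + g₂) p₃<m p₅<m a₃₅ arc₃₅ (by-total (solve gaps))
      ; chord₄₅ = swap (adjacent-arcs (g₄ + g₅) p₁<m p₄<m a₁₄ arc₁₄ (by-total (solve gaps)))
      ; chord₅₁ = swap (adjacent-arcs (g₅ + g₁) p₂<m p₅<m a₂₅ arc₂₅ (by-total (solve gaps)))
      }
      where
      arc₁₃ : offset p₁ p₃ ≡ g₁ + g₂
      arc₁₃ = trans (offset-trans p₁≤p₂ p₂≤p₃) (cong₂ _+_ e₁ e₂)
      arc₂₄ : offset p₂ p₄ ≡ g₂ + g₃
      arc₂₄ = trans (offset-trans p₂≤p₃ p₃≤p₄) (cong₂ _+_ e₂ e₃)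
      arc₃₅ : offset p₃ p₅ ≡ g₃ + g₄
      arc₃₅ = trans (offset-trans p₃≤p₄ p₄≤p₅) (cong₂ _+_ e₃ e₄)
      arc₁₄ : offset p₁ p₄ ≡ g₁ + g₂ + g₃
      arc₁₄ = trans (offset-trans (≤-trans p₁≤p₂ p₂≤p₃) p₃≤p₄) (cong₂ _+_ arc₁₃ e₃)
      arc₂₅ : offset p₂ p₅ ≡ g₂ + g₃ + g₄
      arc₂₅ = trans (offset-trans (≤-trans p₂≤p₃ p₃≤p₄) p₄≤p₅) (cong₂ _+_ arc₂₄ e₄)
      arc₁₅ : offset p₁ p₅ ≡ g₁ + g₂ + g₃ + g₄
      arc₁₅ = trans (offset-trans (≤-trans p₁≤p₂ (≤-trans p₂≤p₃ p₃≤p₄)) p₄≤p₅) (cong₂ _+_ arc₁₄ e₄)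
      total : g₁ + g₂ + g₃ + g₄ + g₅ ≡ m
      total = trans (cong₂ _+_ (sym arc₁₅) (sym e₅))
                    (offset-+-offset p₁<m p₅<m (λ { refl → Adjacent-irreflexive p₁ a₁₅ }))
      by-total : ∀ {s} → s ≡ g₁ + g₂ + g₃ + g₄ + g₅ → s ≡ m
      by-total s≡ = trans s≡ total
      gaps : List ℕ
      gaps = g₁ ∷ g₂ ∷ g₃ ∷ g₄ ∷ g₅ ∷ []

three-short-arcs : ∀ {m b j e a₁ a₂ a₃} → (3 + j) * b + (3 + j) * b ≤ m + 2 →
  a₁ < (2 + j) * b → a₂ < (2 + j) * b → a₃ < (2 + j) * b → a₁ + a₂ + a₃ ≡ m + e → j * b ≤ e → ⊥
three-short-arcs {m} {b} {j} {e} {a₁} {a₂} {a₃} wide a₁<cb a₂<cb a₃<cb cover excess = <-irrefl refl (begin-strict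
  (3 + j) * b + (3 + j) * b + j * b          ≤⟨ +-mono-≤ wide excess ⟩
  m + 2 + e                                  <⟨ n<1+n _ ⟩
  suc (m + 2 + e)                            ≡⟨ solve (m ∷ e ∷ []) ⟩
  m + e + 3                                  ≡⟨ cong (_+ 3) cover ⟨
  a₁ + a₂ + a₃ + 3                           ≡⟨ solve (a₁ ∷ a₂ ∷ a₃ ∷ []) ⟩
  suc a₁ + suc a₂ + suc a₃                   ≤⟨ +-mono-≤ (+-mono-≤ a₁<cb a₂<cb) a₃<cb ⟩
  (2 + j) * b + (2 + j) * b + (2 + j) * b    ≡⟨ solve (b ∷ j ∷ []) ⟩
  (3 + j) * b + (3 + j) * b + j * b          ∎)
  where open ≤-Reasoning

five-short-arcs-twice : ∀ {m b a₁ a₂ a₃ a₄ a₅} → 5 * b + 5 * b ≤ m + 2 →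
  a₁ < 4 * b → a₂ < 4 * b → a₃ < 4 * b → a₄ < 4 * b → a₅ < 4 * b → a₁ + a₂ + a₃ + a₄ + a₅ ≡ m + m → ⊥
five-short-arcs-twice {m} {b} {a₁} {a₂} {a₃} {a₄} {a₅} wide a₁< a₂< a₃< a₄< a₅< cover = <-irrefl refl (begin-strict
  (5 * b + 5 * b) + (5 * b + 5 * b)          ≤⟨ +-mono-≤ wide wide ⟩
  (m + 2) + (m + 2)                          <⟨ n<1+n _ ⟩
  suc ((m + 2) + (m + 2))                    ≡⟨ solve (m ∷ []) ⟩
  m + m + 5                                  ≡⟨ cong (_+ 5) cover ⟨
  a₁ + a₂ + a₃ + a₄ + a₅ + 5                 ≡⟨ solve (a₁ ∷ a₂ ∷ a₃ ∷ a₄ ∷ a₅ ∷ []) ⟩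
  suc a₁ + suc a₂ + suc a₃ + suc a₄ + suc a₅ ≤⟨ +-mono-≤ (+-mono-≤ (+-mono-≤ (+-mono-≤ a₁< a₂<) a₃<) a₄<) a₅< ⟩
  4 * b + 4 * b + 4 * b + 4 * b + 4 * b      ≡⟨ solve (b ∷ []) ⟩
  (5 * b + 5 * b) + (5 * b + 5 * b)          ∎)
  where open ≤-Reasoning

module _ (b c : ℕ) where

  InBand : ℕ → Set
  InBand d = b ≤ d × d < c * b

  inBand? : Decidable InBand
  inBand? d = (b ≤? d) ×-dec (d <? c * b)

  ¬InBand-0 : ¬ InBand 0
  ¬InBand-0 (b≤0 , 0<cb) = <-irrefl (sym (trans (cong (c *_) (n≤0⇒n≡0 b≤0)) (*-zeroʳ c))) 0<cb

  chord-lower : ∀ {m g r} → suc c * b + suc c * b ≤ m + 2 → g + r ≡ m → InBand g ⊎ InBand r → b ≤ g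
  chord-lower _ _ (inj₁ (b≤g , _)) = b≤g
  chord-lower {m} {g} {r} wide g+r≡m (inj₂ (b≤r , r<cb)) = ≮⇒≥ λ g<b → <-irrefl refl (begin-strict
    suc c * b                  <⟨ m<m+n (suc c * b) (≤-<-trans z≤n (<-≤-trans r<cb (m≤n+m (c * b) b))) ⟩
    suc c * b + suc c * b      ≤⟨ wide ⟩
    m + 2                      ≡⟨ cong (_+ 2) g+r≡m ⟨
    g + r + 2                  ≡⟨ solve (g ∷ r ∷ []) ⟩
    suc g + suc r              ≤⟨ +-mono-≤ g<b r<cb ⟩
    suc c * b                  ∎)
    where open ≤-Reasoning

  chord-short : ∀ {g r} → c * b ≤ r → InBand g ⊎ InBand r → g < c * b
  chord-short _    (inj₁ (_ , g<cb)) = g<cb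
  chord-short cb≤r (inj₂ (_ , r<cb)) = ⊥-elim (<⇒≱ r<cb cb≤r)

bandCirculant : (m b c : ℕ) → Graph m
bandCirculant m b c = Circulant.circulant m (InBand b c) (inBand? b c) (¬InBand-0 b c)

module _ (m b : ℕ) (wide : 4 * b + 4 * b ≤ m + 2) where
  open Circulant m (InBand b 3) (inBand? b 3) (¬InBand-0 b 3)
  open CyclicGaps₄

  private
    rotate₄² rotate₄³ : CyclicGaps₄ → CyclicGaps₄
    rotate₄² C = rotate₄ (rotate₄ C)
    rotate₄³ C = rotate₄ (rotate₄² C)

  gap-lower₄ : (C : CyclicGaps₄) → b ≤ g₁ C
  gap-lower₄ record { g₁ = g₁ ; g₂ = g₂ ; g₃ = g₃ ; g₄ = g₄ ; total = total ; chord₁ = chord₁ } =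
    chord-lower b 3 wide (begin
      g₁ + (g₂ + g₃ + g₄)   ≡⟨ solve (g₁ ∷ g₂ ∷ g₃ ∷ g₄ ∷ []) ⟩
      g₁ + g₂ + g₃ + g₄     ≡⟨ total ⟩
      m                     ∎) chord₁
    where open ≡-Reasoning

  gap-in-band₄ : (C : CyclicGaps₄) → InBand b 3 (g₁ C)
  gap-in-band₄ C = gap-lower₄ C , chord-short b 3 (begin
    3 * b             ≡⟨ solve (b ∷ []) ⟩
    b + b + b         ≤⟨ +-mono-≤ (+-mono-≤ (gap-lower₄ (rotate₄ C)) (gap-lower₄ (rotate₄² C))) (gap-lower₄ (rotate₄³ C)) ⟩
    g₂ C + g₃ C + g₄ C ∎) (chord₁ C)
    where open ≤-Reasoning

  overlapping-pairs : (C : CyclicGaps₄) → InBand b 3 (g₁ C + g₂ C) → InBand b 3 (g₂ C + g₃ C) → ⊥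
  overlapping-pairs C@record { g₁ = g₁ ; g₂ = g₂ ; g₃ = g₃ ; g₄ = g₄ ; total = total } (_ , short₁₂) (_ , short₂₃) =
    three-short-arcs {j = 1} wide short₁₂ short₂₃ (proj₂ (gap-in-band₄ (rotate₄³ C))) cover
      (≤-trans (≤-reflexive (*-identityˡ b)) (gap-lower₄ (rotate₄ C)))
    where
    cover : g₁ + g₂ + (g₂ + g₃) + g₄ ≡ m + g₂
    cover = begin
      g₁ + g₂ + (g₂ + g₃) + g₄   ≡⟨ solve (g₁ ∷ g₂ ∷ g₃ ∷ g₄ ∷ []) ⟩
      g₁ + g₂ + g₃ + g₄ + g₂     ≡⟨ cong (_+ g₂) total ⟩
      m + g₂                     ∎
      where open ≡-Reasoning

  no-cyclic-gaps₄ : ¬ CyclicGaps₄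
  no-cyclic-gaps₄ C with chord₁₂ C | chord₂₃ C
  ... | inj₁ short₁₂ | inj₁ short₂₃ = overlapping-pairs C short₁₂ short₂₃
  ... | inj₁ short₁₂ | inj₂ short₄₁ = overlapping-pairs (rotate₄³ C) short₄₁ short₁₂
  ... | inj₂ short₃₄ | inj₁ short₂₃ = overlapping-pairs (rotate₄ C) short₂₃ short₃₄
  ... | inj₂ short₃₄ | inj₂ short₄₁ = overlapping-pairs (rotate₄² C) short₃₄ short₄₁

  K₄-free : ¬ ContainsK (bandCirculant m b 3) 4
  K₄-free K = no-cyclic-gaps₄ (cyclic-gaps₄ K)

module _ (m b : ℕ) (wide : 5 * b + 5 * b ≤ m + 2) where
  open Circulant m (InBand b 4) (inBand? b 4) (¬InBand-0 b 4)
  open CyclicGaps₅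

  private
    rotate₅² rotate₅³ rotate₅⁴ : CyclicGaps₅ → CyclicGaps₅
    rotate₅² C = rotate₅ (rotate₅ C)
    rotate₅³ C = rotate₅ (rotate₅² C)
    rotate₅⁴ C = rotate₅ (rotate₅³ C)

    2*b≤x+y : ∀ {x y} → b ≤ x → b ≤ y → 2 * b ≤ x + y
    2*b≤x+y {x} {y} b≤x b≤y = begin
      2 * b   ≡⟨ solve (b ∷ []) ⟩
      b + b   ≤⟨ +-mono-≤ b≤x b≤y ⟩
      x + y   ∎
      where open ≤-Reasoning

  gap-lower₅ : (C : CyclicGaps₅) → b ≤ g₁ C
  gap-lower₅ record { g₁ = g₁ ; g₂ = g₂ ; g₃ = g₃ ; g₄ = g₄ ; g₅ = g₅ ; total = total ; chord₁ = chord₁ } =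
    chord-lower b 4 wide (begin
      g₁ + (g₂ + g₃ + g₄ + g₅)   ≡⟨ solve (g₁ ∷ g₂ ∷ g₃ ∷ g₄ ∷ g₅ ∷ []) ⟩
      g₁ + g₂ + g₃ + g₄ + g₅     ≡⟨ total ⟩
      m                          ∎) chord₁
    where open ≡-Reasoning

  gap-in-band₅ : (C : CyclicGaps₅) → InBand b 4 (g₁ C)
  gap-in-band₅ C = gap-lower₅ C , chord-short b 4 (begin
    4 * b                     ≡⟨ solve (b ∷ []) ⟩
    2 * b + 2 * b             ≤⟨ +-mono-≤ (2*b≤x+y (gap-lower₅ (rotate₅ C)) (gap-lower₅ (rotate₅² C)))
                                          (2*b≤x+y (gap-lower₅ (rotate₅³ C)) (gap-lower₅ (rotate₅⁴ C))) ⟩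
    g₂ C + g₃ C + (g₄ C + g₅ C) ≡⟨ +-assoc (g₂ C + g₃ C) (g₄ C) (g₅ C) ⟨
    g₂ C + g₃ C + g₄ C + g₅ C ∎) (chord₁ C)
    where open ≤-Reasoning

  -- If g₃ + g₄ + g₅ is short, then so are g₂ + g₃ and g₅ + g₁ (a short triple g₄ + g₅ + g₁ or
  -- g₂ + g₃ + g₄ would overlap it in two gaps), and these three arcs overlap in g₃ and g₅.
  short-triple : (C : CyclicGaps₅) → InBand b 4 (g₃ C + g₄ C + g₅ C) → ⊥
  short-triple C@record { g₁ = g₁ ; g₂ = g₂ ; g₃ = g₃ ; g₄ = g₄ ; g₅ = g₅ ; total = total } (_ , short₃₄₅)
    with chord₂₃ C | chord₅₁ C
  ... | inj₂ (_ , short₄₅₁) | _ =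
    three-short-arcs {b = b} {j = 2} wide short₃₄₅ short₄₅₁ (proj₂ (gap-in-band₅ (rotate₅ C))) cover
      (2*b≤x+y (gap-lower₅ (rotate₅³ C)) (gap-lower₅ (rotate₅⁴ C)))
    where
    cover : g₃ + g₄ + g₅ + (g₄ + g₅ + g₁) + g₂ ≡ m + (g₄ + g₅)
    cover = begin
      g₃ + g₄ + g₅ + (g₄ + g₅ + g₁) + g₂   ≡⟨ solve (g₁ ∷ g₂ ∷ g₃ ∷ g₄ ∷ g₅ ∷ []) ⟩
      g₁ + g₂ + g₃ + g₄ + g₅ + (g₄ + g₅)   ≡⟨ cong (_+ (g₄ + g₅)) total ⟩
      m + (g₄ + g₅)                        ∎
      where open ≡-Reasoning
  ... | _ | inj₂ (_ , short₂₃₄) =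
    three-short-arcs {b = b} {j = 2} wide short₃₄₅ short₂₃₄ (proj₂ (gap-in-band₅ C)) cover
      (2*b≤x+y (gap-lower₅ (rotate₅² C)) (gap-lower₅ (rotate₅³ C)))
    where
    cover : g₃ + g₄ + g₅ + (g₂ + g₃ + g₄) + g₁ ≡ m + (g₃ + g₄)
    cover = begin
      g₃ + g₄ + g₅ + (g₂ + g₃ + g₄) + g₁   ≡⟨ solve (g₁ ∷ g₂ ∷ g₃ ∷ g₄ ∷ g₅ ∷ []) ⟩
      g₁ + g₂ + g₃ + g₄ + g₅ + (g₃ + g₄)   ≡⟨ cong (_+ (g₃ + g₄)) total ⟩
      m + (g₃ + g₄)                        ∎
      where open ≡-Reasoning
  ... | inj₁ (_ , short₂₃) | inj₁ (_ , short₅₁) =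
    three-short-arcs {b = b} {j = 2} wide short₂₃ short₅₁ short₃₄₅ cover
      (2*b≤x+y (gap-lower₅ (rotate₅² C)) (gap-lower₅ (rotate₅⁴ C)))
    where
    cover : g₂ + g₃ + (g₅ + g₁) + (g₃ + g₄ + g₅) ≡ m + (g₃ + g₅)
    cover = begin
      g₂ + g₃ + (g₅ + g₁) + (g₃ + g₄ + g₅) ≡⟨ solve (g₁ ∷ g₂ ∷ g₃ ∷ g₄ ∷ g₅ ∷ []) ⟩
      g₁ + g₂ + g₃ + g₄ + g₅ + (g₃ + g₅)   ≡⟨ cong (_+ (g₃ + g₅)) total ⟩
      m + (g₃ + g₅)                        ∎
      where open ≡-Reasoning

  twice-around : (C : CyclicGaps₅) → (g₁ C + g₂ C) + (g₂ C + g₃ C) + (g₃ C + g₄ C) + (g₄ C + g₅ C) + (g₅ C + g₁ C) ≡ m + m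
  twice-around record { g₁ = g₁ ; g₂ = g₂ ; g₃ = g₃ ; g₄ = g₄ ; g₅ = g₅ ; total = total } = begin
    (g₁ + g₂) + (g₂ + g₃) + (g₃ + g₄) + (g₄ + g₅) + (g₅ + g₁)   ≡⟨ solve (g₁ ∷ g₂ ∷ g₃ ∷ g₄ ∷ g₅ ∷ []) ⟩
    (g₁ + g₂ + g₃ + g₄ + g₅) + (g₁ + g₂ + g₃ + g₄ + g₅)         ≡⟨ cong₂ _+_ total total ⟩
    m + m                                                       ∎
    where open ≡-Reasoning

  no-cyclic-gaps₅ : ¬ CyclicGaps₅
  no-cyclic-gaps₅ C with chord₁₂ C
  ... | inj₂ short = short-triple C short
  ... | inj₁ (_ , short₁₂) with chord₂₃ C
  ...   | inj₂ short = short-triple (rotate₅ C) short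
  ...   | inj₁ (_ , short₂₃) with chord₃₄ C
  ...     | inj₂ short = short-triple (rotate₅² C) short
  ...     | inj₁ (_ , short₃₄) with chord₄₅ C
  ...       | inj₂ short = short-triple (rotate₅³ C) short
  ...       | inj₁ (_ , short₄₅) with chord₅₁ C
  ...         | inj₂ short = short-triple (rotate₅⁴ C) short
  ...         | inj₁ (_ , short₅₁) = five-short-arcs-twice {b = b} wide short₁₂ short₂₃ short₃₄ short₄₅ short₅₁ (twice-around C)

  K₅-free : ¬ ContainsK (bandCirculant m b 4) 5
  K₅-free K = no-cyclic-gaps₅ (cyclic-gaps₅ K)

excess+2≤b : ∀ {m b c e} → (suc c * b + e) + (suc c * b + e) ≤ m → m + 3 ≤ suc (suc c) * b + suc (suc c) * b → e + 2 ≤ b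
excess+2≤b {m} {b} {c} {e} 2δ≤m narrow = ≮⇒≥ λ b<e+2 → <-irrefl refl (begin-strict
  b + b                   ≤⟨ +-mono-≤ (b≤1+e b<e+2) (b≤1+e b<e+2) ⟩
  suc e + suc e           <⟨ n<1+n _ ⟩
  suc (suc e + suc e)     ≡⟨ solve (e ∷ []) ⟩
  e + e + 3               ≤⟨ +-cancelˡ-≤ (suc c * b + suc c * b) _ _ (begin
      suc c * b + suc c * b + (e + e + 3)   ≡⟨ solve (c ∷ b ∷ e ∷ []) ⟩
      (suc c * b + e) + (suc c * b + e) + 3 ≤⟨ +-monoˡ-≤ 3 2δ≤m ⟩
      m + 3                                 ≤⟨ narrow ⟩
      suc (suc c) * b + suc (suc c) * b     ≡⟨ solve (c ∷ b ∷ []) ⟩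
      suc c * b + suc c * b + (b + b)       ∎) ⟩
  b + b                   ∎)
  where
  open ≤-Reasoning
  b≤1+e : b < e + 2 → b ≤ suc e
  b≤1+e b<e+2 = s≤s⁻¹ (≤-trans b<e+2 (≤-reflexive (+-comm e 2)))

split-far-distance : ∀ {m b c δ} → 1 ≤ b → c * b ≤ δ → δ + δ ≤ m → m + 3 ≤ suc (suc c) * b + suc (suc c) * b →
  Σ ℕ λ t → Σ ℕ λ D → t + D ≡ δ × t < b × c * b ≤ D × D < suc c * b
split-far-distance {m} {b} {c} {δ} 1≤b cb≤δ 2δ≤m narrow with δ <? suc c * b
... | yes δ<c′b = 0 , δ , refl , 1≤b , cb≤δ , δ<c′b
... | no δ≮c′b with m≤n⇒∃[o]m+o≡n (≮⇒≥ δ≮c′b)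
...   | e , refl with m≤n⇒∃[o]m+o≡n (excess+2≤b {m} {b} {c} {e} 2δ≤m narrow)
...     | f , refl =
  suc e , c * (e + 2 + f) + suc (e + f) ,
  solve (c ∷ e ∷ f ∷ []) ,
  ≤-trans (≤-reflexive (+-comm 2 e)) (m≤m+n (e + 2) f) ,
  m≤m+n (c * (e + 2 + f)) _ ,
  ≤-reflexive (solve (c ∷ e ∷ f ∷ []))

module _ (m b k : ℕ) (1≤b : 1 ≤ b)
         (wide : suc (suc k) * b + suc (suc k) * b ≤ m + 2)
         (narrow : m + 3 ≤ suc (suc (suc k)) * b + suc (suc (suc k)) * b) where
  open Cyclic m
  open Circulant m (InBand b (suc k)) (inBand? b (suc k)) (¬InBand-0 b (suc k))

  private
    G : Graph m
    G = circulant

  band<m : ∀ {d} → InBand b (suc k) d → d < m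
  band<m {d} (_ , d<cb) = <-≤-trans d<cb (+-cancelʳ-≤ 2 _ _ (begin
    suc k * b + 2                             ≤⟨ +-monoʳ-≤ (suc k * b) (+-mono-≤ 1≤b 1≤b) ⟩
    suc k * b + (b + b)                       ≤⟨ m≤m+n _ (suc k * b) ⟩
    suc k * b + (b + b) + suc k * b           ≡⟨ solve (k ∷ b ∷ []) ⟩
    suc (suc k) * b + suc (suc k) * b         ≤⟨ wide ⟩
    m + 2                                     ∎))
    where open ≤-Reasoning

  multiple-in-band : ∀ {i} → i < k → InBand b (suc k) (suc i * b)
  multiple-in-band {i} i<k = m≤m+n b (i * b) , ≤-<-trans (*-monoˡ-≤ b i<k) (m<n+m (k * b) 1≤b)

  shifted-multiple-in-band : ∀ {t i} → t < b → i < k → InBand b (suc k) (t + suc i * b)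
  shifted-multiple-in-band {t} {i} t<b i<k = ≤-trans (m≤m+n b (i * b)) (m≤n+m _ t) , (begin-strict
    t + suc i * b     <⟨ +-monoˡ-< (suc i * b) t<b ⟩
    b + suc i * b     ≤⟨ +-monoʳ-≤ b (*-monoˡ-≤ b i<k) ⟩
    b + k * b         ∎)
    where open ≤-Reasoning

  positions-adjacent : ∀ {p q d} (p<m : p < m) (q<m : q < m) → p + d ≡ q → InBand b (suc k) d →
    Adj G (position p<m) (position q<m)
  positions-adjacent {p} {q} {d} p<m q<m p+d≡q d∈band = inj₁ (subst (InBand b (suc k)) (sym offset≡d) d∈band)
    where
    offset≡d : offset (toℕ (position p<m)) (toℕ (position q<m)) ≡ d
    offset≡d = begin
      offset (toℕ (position p<m)) (toℕ (position q<m)) ≡⟨ cong₂ offset (toℕ-fromℕ< p<m) (toℕ-fromℕ< q<m) ⟩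
      offset p q                                      ≡⟨ offset-≤ (subst (p ≤_) p+d≡q (m≤m+n p d)) ⟩
      q ∸ p                                           ≡⟨ cong (_∸ p) p+d≡q ⟨
      p + d ∸ p                                       ≡⟨ m+n∸m≡n p d ⟩
      d                                               ∎
      where open ≡-Reasoning

  witness<m : ∀ {t} → t < b → (i : Fin k) → t + suc (toℕ i) * b < m
  witness<m t<b i = band<m (shifted-multiple-in-band t<b (toℕ<n i))

  witness : ∀ {t} → t < b → Fin k → Fin m
  witness t<b i = position (witness<m t<b i)

  witnesses-adjacent : ∀ {t} (t<b : t < b) {i j} → i Fin.< j → Adj G (witness t<b i) (witness t<b j)
  witnesses-adjacent {t} t<b {i} {j} i<j = uncurry adjacent-across (m≤n⇒∃[o]m+o≡n i<j)
    where
    adjacent-across : ∀ o → suc (toℕ i) + o ≡ toℕ j → Adj G (witness t<b i) (witness t<b j)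
    adjacent-across o 1+i+o≡j =
      positions-adjacent (witness<m t<b i) (witness<m t<b j) (begin
        t + suc (toℕ i) * b + suc o * b   ≡⟨ regroup (toℕ i) ⟩
        t + suc (suc (toℕ i) + o) * b     ≡⟨ cong (λ n → t + suc n * b) 1+i+o≡j ⟩
        t + suc (toℕ j) * b               ∎)
        (multiple-in-band (<-trans (subst (o <_) 1+i+o≡j (m<n+m o z<s)) (toℕ<n j)))
      where
      open ≡-Reasoning
      regroup : ∀ n → t + suc n * b + suc o * b ≡ t + suc (suc n + o) * b
      regroup n = solve (t ∷ n ∷ o ∷ b ∷ [])

  clique-through-progression : ∀ {δ t} (0<m : 0 < m) (δ<m : δ < m) (t<b : t < b) → 0 < δ →
    (∀ i → Adj G (position δ<m) (witness t<b i)) →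
    ContainsKRel (AddEdge G (position 0<m) (position δ<m)) (2 + k)
  clique-through-progression {δ} {t} 0<m δ<m t<b 0<δ δ~w =
    clique-through-edge G (witness t<b) origin≢δ
      (λ i → positions-adjacent 0<m (witness<m t<b i) refl (shifted-multiple-in-band t<b (toℕ<n i)))
      δ~w (witnesses-adjacent t<b)
    where
    origin≢δ : position 0<m ≢ position δ<m
    origin≢δ eq = <-irrefl (trans (sym (toℕ-fromℕ< 0<m)) (trans (cong toℕ eq) (toℕ-fromℕ< δ<m))) 0<δ

  saturating-at-origin : ∀ {δ} (0<m : 0 < m) (δ<m : δ < m) → 0 < δ → δ + δ ≤ m → ¬ InBand b (suc k) δ →
    ContainsKRel (AddEdge G (position 0<m) (position δ<m)) (2 + k)
  saturating-at-origin {δ} 0<m δ<m 0<δ 2δ≤m δ∉band with δ <? b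
  ... | yes δ<b = clique-through-progression 0<m δ<m δ<b 0<δ λ i →
    positions-adjacent δ<m (witness<m δ<b i) refl (multiple-in-band (toℕ<n i))
  ... | no δ≮b with split-far-distance {m} {b} {suc k} 1≤b (≮⇒≥ λ δ<cb → δ∉band (≮⇒≥ δ≮b , δ<cb)) 2δ≤m narrow
  ...   | t , D , t+D≡δ , t<b , cb≤D , D<c′b = clique-through-progression 0<m δ<m t<b 0<δ λ i →
    Graph.sym G {witness t<b i} {position δ<m} (positions-adjacent (witness<m t<b i) δ<m (reach i) (remaining-in-band i))
    where
    step≤D : ∀ (i : Fin k) → suc (toℕ i) * b ≤ D
    step≤D i = ≤-trans (*-monoˡ-≤ b (≤-trans (toℕ<n i) (n≤1+n k))) cb≤D
    reach : ∀ i → t + suc (toℕ i) * b + (D ∸ suc (toℕ i) * b) ≡ δ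
    reach i = begin
      t + suc (toℕ i) * b + (D ∸ suc (toℕ i) * b)   ≡⟨ +-assoc t _ _ ⟩
      t + (suc (toℕ i) * b + (D ∸ suc (toℕ i) * b)) ≡⟨ cong (t +_) (m+[n∸m]≡n (step≤D i)) ⟩
      t + D                                         ≡⟨ t+D≡δ ⟩
      δ                                             ∎
      where open ≡-Reasoning
    remaining-in-band : ∀ i → InBand b (suc k) (D ∸ suc (toℕ i) * b)
    remaining-in-band i =
      m+n≤o⇒m≤o∸n b (≤-trans (*-monoˡ-≤ b (s≤s (toℕ<n i))) cb≤D) ,
      +-cancelʳ-< (suc (toℕ i) * b) _ _ (begin-strict
        D ∸ suc (toℕ i) * b + suc (toℕ i) * b   ≡⟨ m∸n+n≡m (step≤D i) ⟩
        D                                       <⟨ D<c′b ⟩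
        b + suc k * b                           ≤⟨ +-monoˡ-≤ (suc k * b) (m≤m+n b (toℕ i * b)) ⟩
        suc (toℕ i) * b + suc k * b             ≡⟨ +-comm (suc (toℕ i) * b) (suc k * b) ⟩
        suc k * b + suc (toℕ i) * b             ∎)
      where open ≤-Reasoning

  saturating-from : ∀ u v → ¬ Adj G u v → 0 < offset (toℕ u) (toℕ v) →
    offset (toℕ u) (toℕ v) + offset (toℕ u) (toℕ v) ≤ m → ContainsKRel (AddEdge G u v) (2 + k)
  saturating-from u v u≁v 0<δ 2δ≤m =
    subst₂ (λ x y → ContainsKRel (AddEdge G x y) (2 + k))
      (rotation-origin u (position 0<m) (toℕ-fromℕ< 0<m)) (inverseʳ (rotation u))
      (automorphism-clique G (rotation u) (rotation-automorphism u)
        (saturating-at-origin 0<m (offset<m (toℕ<n u) (toℕ<n v)) 0<δ 2δ≤m (u≁v ∘ inj₁)))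
    where
    0<m : 0 < m
    0<m = ≤-<-trans z≤n (toℕ<n u)

  saturating : ∀ u v → u ≢ v → ¬ Adj G u v → ContainsKRel (AddEdge G u v) (2 + k)
  saturating u v u≢v u≁v = [ from-u , from-v ]′ (≤-<-connex δ δ′)
    where
    δ δ′ : ℕ
    δ  = offset (toℕ u) (toℕ v)
    δ′ = offset (toℕ v) (toℕ u)
    δ+δ′≡m : δ + δ′ ≡ m
    δ+δ′≡m = offset-+-offset (toℕ<n u) (toℕ<n v) (u≢v ∘ toℕ-injective)
    from-u : δ ≤ δ′ → ContainsKRel (AddEdge G u v) (2 + k)
    from-u δ≤δ′ = saturating-from u v u≁v (offset-positive (toℕ<n u) (toℕ<n v) (u≢v ∘ toℕ-injective))
                    (≤-trans (+-monoʳ-≤ δ δ≤δ′) (≤-reflexive δ+δ′≡m))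
    from-v : δ′ < δ → ContainsKRel (AddEdge G u v) (2 + k)
    from-v δ′<δ = AddEdge-swap G (saturating-from v u (u≁v ∘ Graph.sym G {v} {u})
                    (offset-positive (toℕ<n v) (toℕ<n u) (u≢v ∘ sym ∘ toℕ-injective))
                    (≤-trans (+-monoˡ-≤ δ′ (<⇒≤ δ′<δ)) (≤-reflexive δ+δ′≡m)))

band-width : ∀ n c → suc c * suc c + suc c * suc c ≤ n + 2 →
  Σ ℕ λ b → 1 ≤ b × suc c * b + suc c * b ≤ n + 2 × n + 3 ≤ suc (suc c) * b + suc (suc c) * b
band-width n c big =
  from-division ((n + 2) / (suc c + suc c)) ((n + 2) % (suc c + suc c))
    (m≡m%n+[m/n]*n (n + 2) (suc c + suc c)) (m%n<n (n + 2) (suc c + suc c)) c<q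
  where
  c<q : suc c ≤ (n + 2) / (suc c + suc c)
  c<q = begin
    suc c                                     ≡⟨ m*n/n≡m (suc c) (suc c + suc c) ⟨
    suc c * (suc c + suc c) / (suc c + suc c) ≤⟨ /-monoˡ-≤ (suc c + suc c) (≤-trans (≤-reflexive c′d≡) big) ⟩
    (n + 2) / (suc c + suc c)                 ∎
    where
    open ≤-Reasoning
    c′d≡ : suc c * (suc c + suc c) ≡ suc c * suc c + suc c * suc c
    c′d≡ = solve (c ∷ [])
  from-division : ∀ q r → n + 2 ≡ r + q * (suc c + suc c) → r < suc c + suc c → suc c ≤ q →
    Σ ℕ λ b → 1 ≤ b × suc c * b + suc c * b ≤ n + 2 × n + 3 ≤ suc (suc c) * b + suc (suc c) * b
  from-division q r n+2≡ r<d c<q = q , ≤-trans (s≤s z≤n) c<q , wide , narrow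
    where
    open ≤-Reasoning
    wide : suc c * q + suc c * q ≤ n + 2
    wide = begin
      suc c * q + suc c * q                 ≡⟨ solve (c ∷ q ∷ []) ⟩
      q * (suc c + suc c)                   ≤⟨ m≤n+m _ r ⟩
      r + q * (suc c + suc c)               ≡⟨ n+2≡ ⟨
      n + 2                                 ∎
    narrow : n + 3 ≤ suc (suc c) * q + suc (suc c) * q
    narrow = begin
      n + 3                                 ≡⟨ solve (n ∷ []) ⟩
      suc (n + 2)                           ≡⟨ cong suc n+2≡ ⟩
      suc r + q * (suc c + suc c)           ≤⟨ +-monoˡ-≤ _ r<d ⟩
      suc c + suc c + q * (suc c + suc c)   ≤⟨ +-monoˡ-≤ _ (+-mono-≤ c<q c<q) ⟩
      q + q + q * (suc c + suc c)           ≡⟨ solve (c ∷ q ∷ []) ⟩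
      suc (suc c) * q + suc (suc c) * q     ∎

regular-saturated-band-circulant : ∀ n k →
  (∀ b → suc (suc k) * b + suc (suc k) * b ≤ n + 2 → ¬ ContainsK (bandCirculant n b (suc k)) (2 + k)) →
  suc (suc k) * suc (suc k) + suc (suc k) * suc (suc k) ≤ n + 2 →
  Σ (Graph n) λ G → Regular G × Saturated G (2 + k)
regular-saturated-band-circulant n k K-free big = from-width (band-width n (suc k) big)
  where
  from-width : (Σ ℕ λ b → 1 ≤ b × suc (suc k) * b + suc (suc k) * b ≤ n + 2 ×
                           n + 3 ≤ suc (suc (suc k)) * b + suc (suc (suc k)) * b) →
               Σ (Graph n) λ G → Regular G × Saturated G (2 + k)
  from-width (b , 1≤b , wide , narrow) =
    bandCirculant n b (suc k) ,
    Circulant.circulant-regular n (InBand b (suc k)) (inBand? b (suc k)) (¬InBand-0 b (suc k)) ,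
    K-free b wide ,
    saturating n b k 1≤b wide narrow

theorem1p1 : (n : ℕ) → 59 < n →
    (Σ (Graph n) λ G → Regular G × Saturated G 4) ×
    (Σ (Graph n) λ G → Regular G × Saturated G 5)
theorem1p1 n 59<n =
  regular-saturated-band-circulant n 2 (K₄-free n) (≤-trans (m≤m+n 32 28) (≤-trans 59<n (m≤m+n n 2))) ,
  regular-saturated-band-circulant n 3 (K₅-free n) (≤-trans (m≤m+n 50 10) (≤-trans 59<n (m≤m+n n 2)))
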